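{- Let $G$ be a finite, simple, connected graph with at least one edge, on vertex set $\{1,\dots,N\}$, let $\nabla_G=\{\pm(\mathbf e_i-\mathbf e_j)\mid \{i,j\}\in\mathcal E(G)\}\subset\mathbb R^N$, and let $F$ be a facet of $\nabla_G$. Then $$|\{F'\mid F'\text{ a facet of }\nabla_G,\ G_{F'}=G_F\}|\le 2^{N-1}.$$
   Context: $\mathbf e_1,\dots,\mathbf e_N$ is the standard basis of $\mathbb R^N$. A subset $F\subseteq\nabla_G$ is a facet of $\nabla_G$ if $F=\nabla_G\cap P'$ for a facet $P'$ of the polytope $\operatorname{conv}(\nabla_G)$. For nonempty $X\subseteq\nabla_G$, $G_X$ is the undirected graph whose edges are the $\{i,j\}$ with $\mathbf e_i-\mathbf e_j\in X$ or $\mathbf e_j-\mathbf e_i\in X$, and whose vertices are the endpoints of these edges. -}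

module Defs where

open import Data.Nat using (ℕ)
open import Data.Fin using (Fin)
open import Data.Bool using (Bool; true; false)
open import Data.Product using (Σ; ∃; _×_; _,_)
open import Data.Sum using (_⊎_)
open import Data.Rational using (ℚ; _-_; _≤_)
open import Relation.Nullary using (¬_)
open import Relation.Binary.PropositionalEquality using (_≡_)
open import Function.Bundles using (_⇔_)

record SimpleGraph (N : ℕ) : Set where
  field
    adj    : Fin N → Fin N → Bool
    sym    : ∀ i j → adj i j ≡ adj j i
    irrefl : ∀ i → adj i i ≡ false

open SimpleGraph public

data Reachable {N : ℕ} (G : SimpleGraph N) : Fin N → Fin N → Set where
  here : ∀ i → Reachable G i i
  step : ∀ {i j k} → adj G i j ≡ true → Reachable G j k → Reachable G i k

Connected : {N : ℕ} → SimpleGraph N → Set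
Connected G = ∀ i j → Reachable G i j

HasEdge : {N : ℕ} → SimpleGraph N → Set
HasEdge {N} G = Σ (Fin N) λ i → Σ (Fin N) λ j → adj G i j ≡ true

-- A subset X of ℝ^N's finite point set ∇_G is encoded by its indicator on
-- ordered pairs: X i j ≡ true means  e_i - e_j ∈ X.  Since G is loopless,
-- distinct ordered pairs (i,j) with i ≠ j give distinct vectors e_i - e_j,
-- and ∇_G = { e_i - e_j | adj G i j ≡ true } (both orientations of each edge).
Sub : ℕ → Set
Sub N = Fin N → Fin N → Bool

_⊆∇_ : {N : ℕ} → Sub N → SimpleGraph N → Set
X ⊆∇ G = ∀ i j → X i j ≡ true → adj G i j ≡ true

_⊆ˢ_ : {N : ℕ} → Sub N → Sub N → Set
X ⊆ˢ Y = ∀ i j → X i j ≡ true → Y i j ≡ true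

SameSub : {N : ℕ} → Sub N → Sub N → Set
SameSub X Y = ∀ i j → X i j ≡ Y i j

-- X = ∇_G ∩ P' for a face P' of conv(∇_G): there is a (rational) linear
-- functional a and bound b with  a·x ≤ b  on ∇_G, and X consists exactly of
-- the points of ∇_G where equality holds.  Note a·(e_i - e_j) = a i - a j.
IsFace : {N : ℕ} → SimpleGraph N → Sub N → Set
IsFace {N} G X =
  X ⊆∇ G ×
  Σ (Fin N → ℚ) λ a → Σ ℚ λ b →
    (∀ i j → adj G i j ≡ true → (a i - a j) ≤ b) ×
    (∀ i j → adj G i j ≡ true → (X i j ≡ true ⇔ (a i - a j) ≡ b))

IsProperFace : {N : ℕ} → SimpleGraph N → Sub N → Set
IsProperFace G X = IsFace G X × ¬ (∀ i j → adj G i j ≡ true → X i j ≡ true)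

IsFacet : {N : ℕ} → SimpleGraph N → Sub N → Set
IsFacet G X =
  IsProperFace G X ×
  (∀ Y → IsProperFace G Y → X ⊆ˢ Y → SameSub Y X)

GEdge : {N : ℕ} → Sub N → Fin N → Fin N → Set
GEdge X i j = X i j ≡ true ⊎ X j i ≡ true

GVertex : {N : ℕ} → Sub N → Fin N → Set
GVertex {N} X i = ∃ λ (j : Fin N) → GEdge X i j

SameGraph : {N : ℕ} → Sub N → Sub N → Set
SameGraph X Y =
  (∀ i j → GEdge X i j ⇔ GEdge Y i j) × (∀ i → GVertex X i ⇔ GVertex Y i)

{-# OPTIONS --safe #-}
-- Since ∇_G = -∇_G, a proper face X of ∇_G has a normal (a , b) with b ≠ 0, and X is the
-- set of vectors e_i - e_j of ∇_G along which the potential c = a / b drops by one.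
-- If G_X = G_F, each edge of G_F lies in X in exactly one orientation, so along a
-- spanning forest of G_F these orientations fix c up to a constant on each tree, and
-- thereby fix X. The forest has at most N - 1 edges, hence at most 2^(N-1) such facets.
module Submission where

open import Data.Bool using (Bool; true; false; if_then_else_)
open import Data.Bool.Properties using (⇔→≡) renaming (_≟_ to _≟ᴮ_)
open import Data.Fin using (Fin; zero; suc; punchIn; punchOut; funToFin; finToFun)
open import Data.Fin.Properties using (_≟_; 2↔Bool; finToFun-funToFin; injective⇒≤; punchIn-punchOut)
open import Data.List using (List; []; _∷_; length; lookup; map; foldr; cartesianProduct; allFin)
open import Data.List.Membership.Propositional using (_∈_)
open import Data.List.Membership.Propositional.Properties using (∈-lookup; ∈-cartesianProduct⁺; ∈-allFin)
open import Data.List.Properties using (length-map)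
open import Data.List.Relation.Unary.All as All using (All; []; _∷_)
open import Data.List.Relation.Unary.All.Properties as All using ()
open import Data.List.Relation.Unary.AllPairs using (AllPairs; []; _∷_)
open import Data.List.Relation.Unary.Any using (here; there)
open import Data.List.Relation.Unary.Unique.Propositional using (Unique)
open import Data.Maybe using (Maybe; just; nothing; maybe′)
open import Data.Maybe.Properties using (just-injective)
open import Data.Nat using (ℕ; zero; suc; _≤_; _^_; _∸_)
open import Data.Nat.Properties using (module ≤-Reasoning)
open import Data.Product using (Σ; _×_; _,_; proj₂; uncurry)
open import Data.Rational using (ℚ; 0ℚ; 1ℚ; _+_; _-_; _*_; _÷_; 1/_; -_; NonZero; ≢-nonZero)
  renaming (_≤_ to _≤ℚ_)
open import Data.Rational.Properties
  using (≤-antisym; neg-antimono-≤; *-inverseʳ; *-inverseˡ; *-identityʳ; *-identityˡ; *-assoc)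
open import Data.Rational.Solver using (module +-*-Solver)
open +-*-Solver using (solve; _:+_; _:-_; _:*_; :-_; _:=_)
open import Data.Sum using (inj₁; inj₂)
open import Function using (_∘_; Inverse; _⇔_; mk⇔)
open import Function.Bundles using (module Equivalence)
open Equivalence using (to; from)
open import Function.Definitions using (Injective)
open import Relation.Binary.Definitions using (Decidable)
open import Relation.Binary.PropositionalEquality
open import Relation.Nullary using (¬_; yes; no; does; contradiction)
open import Relation.Nullary.Decidable using (toSum; _⊎-dec_)

open import Defs hiding (sym)

private
  variable
    A B : Set
    N k n : ℕ

lookup-injective : {xs : List (Fin k)} → Unique xs → Injective _≡_ _≡_ (lookup xs)
lookup-injective (_ ∷ _)      {zero}  {zero}  _  = refl
lookup-injective (x∉xs ∷ _)   {zero}  {suc j} eq = contradiction eq (All.lookup x∉xs (∈-lookup j))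
lookup-injective (x∉xs ∷ _)   {suc i} {zero}  eq = contradiction (sym eq) (All.lookup x∉xs (∈-lookup i))
lookup-injective (_ ∷ unique) {suc i} {suc j} eq = cong suc (lookup-injective unique eq)

Unique⇒length≤ : {xs : List (Fin k)} → Unique xs → length xs ≤ k
Unique⇒length≤ unique = injective⇒≤ (lookup-injective unique)

allPairs-map : {P : A → Set} {R : A → A → Set} {S : B → B → Set} {f : A → B} →
               (∀ {x y} → P x → P y → R x y → S (f x) (f y)) →
               {xs : List A} → All P xs → AllPairs R xs → AllPairs S (map f xs)
allPairs-map f-resp []         []           = []
allPairs-map f-resp (px ∷ pxs) (Rx ∷ Rxs) =
  All.map⁺ (All.zipWith (λ (py , Rxy) → f-resp px py Rxy) (pxs , Rx)) ∷ allPairs-map f-resp pxs Rxs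

boolsToFin : (Fin n → Bool) → Fin (2 ^ n)
boolsToFin b = funToFin (Inverse.from 2↔Bool ∘ b)

finToBools : Fin (2 ^ n) → Fin n → Bool
finToBools i = Inverse.to 2↔Bool ∘ finToFun i

finToBools-boolsToFin : (b : Fin n → Bool) → ∀ k → finToBools (boolsToFin b) k ≡ b k
finToBools-boolsToFin b k =
  trans (cong (Inverse.to 2↔Bool) (finToFun-funToFin _ k)) (Inverse.strictlyInverseˡ 2↔Bool (b k))

boolsToFin-injective : {b₁ b₂ : Fin n → Bool} → boolsToFin b₁ ≡ boolsToFin b₂ → ∀ k → b₁ k ≡ b₂ k
boolsToFin-injective {b₁ = b₁} {b₂} eq k = begin
  b₁ k                         ≡⟨ finToBools-boolsToFin b₁ k ⟨
  finToBools (boolsToFin b₁) k ≡⟨ cong (λ i → finToBools i k) eq ⟩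
  finToBools (boolsToFin b₂) k ≡⟨ finToBools-boolsToFin b₂ k ⟩
  b₂ k                         ∎
  where open ≡-Reasoning

-- A forest in union-find form: root x is the root of the tree of x, and link x is the edge
-- (u , v) that was added when the tree then rooted at x, containing v, was hung below u.
record Forest (N : ℕ) : Set where
  field
    root : Fin N → Fin N
    link : Fin N → Maybe (Fin N × Fin N)

open Forest

LinkConstant : Forest N → (Fin N → A) → Set
LinkConstant f g = ∀ x {u v} → link f x ≡ just (u , v) → g u ≡ g v

record IsForest {N} (H : Fin N → Fin N → Set) (f : Forest N) : Set₁ where
  field
    root-idem     : ∀ x → root f (root f x) ≡ root f x
    root-unlinked : ∀ x → root f x ≡ x → link f x ≡ nothing
    link-edge     : ∀ x {u v} → link f x ≡ just (u , v) → H u v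
    -- every vertex is joined to its root by a path of links
    linkConstant⇒rootConstant : {A : Set} (g : Fin N → A) → LinkConstant f g → ∀ x → g x ≡ g (root f x)

discrete : Forest N
discrete = record { root = λ x → x ; link = λ _ → nothing }

discrete-isForest : {H : Fin N → Fin N → Set} → IsForest H discrete
discrete-isForest = record
  { root-idem                 = λ _ → refl
  ; root-unlinked             = λ _ _ → refl
  ; link-edge                 = λ _ ()
  ; linkConstant⇒rootConstant = λ _ _ _ → refl
  }

attach : Forest N → Fin N → Fin N → Forest N
attach f u v = record
  { root = λ w → if does (root f w ≟ root f v) then root f u else root f w
  ; link = λ x → if does (x ≟ root f v) then just (u , v) else link f x
  }

module _ (f : Forest N) (u v : Fin N) where

  private
    f′ : Forest N
    f′ = attach f u v

  attach-root-moved : ∀ {w} → root f w ≡ root f v → root f′ w ≡ root f u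
  attach-root-moved {w} p with root f w ≟ root f v
  ... | yes _ = refl
  ... | no ¬p = contradiction p ¬p

  attach-root-kept : ∀ {w} → root f w ≢ root f v → root f′ w ≡ root f w
  attach-root-kept {w} ¬p with root f w ≟ root f v
  ... | yes p = contradiction p ¬p
  ... | no _  = refl

  attach-link-new : ∀ {x} → x ≡ root f v → link f′ x ≡ just (u , v)
  attach-link-new {x} p with x ≟ root f v
  ... | yes _ = refl
  ... | no ¬p = contradiction p ¬p

  attach-link-kept : ∀ {x} → x ≢ root f v → link f′ x ≡ link f x
  attach-link-kept {x} ¬p with x ≟ root f v
  ... | yes p = contradiction p ¬p
  ... | no _  = refl

module _ {H : Fin N → Fin N → Set} {f : Forest N} (isForest : IsForest H f)
         {u v : Fin N} (edge : H u v) (apart : root f u ≢ root f v) where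

  open IsForest isForest
  private
    f′ : Forest N
    f′ = attach f u v

  attach-root-idem : ∀ w → root f′ (root f′ w) ≡ root f′ w
  attach-root-idem w with toSum (root f w ≟ root f v)
  ... | inj₁ p = begin
    root f′ (root f′ w) ≡⟨ cong (root f′) (attach-root-moved f u v p) ⟩
    root f′ (root f u)  ≡⟨ attach-root-kept f u v (λ q → apart (trans (sym (root-idem u)) q)) ⟩
    root f (root f u)   ≡⟨ root-idem u ⟩
    root f u            ≡⟨ attach-root-moved f u v p ⟨
    root f′ w           ∎
    where open ≡-Reasoning
  ... | inj₂ ¬p = begin
    root f′ (root f′ w) ≡⟨ cong (root f′) (attach-root-kept f u v ¬p) ⟩
    root f′ (root f w)  ≡⟨ attach-root-kept f u v (λ q → ¬p (trans (sym (root-idem w)) q)) ⟩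
    root f (root f w)   ≡⟨ root-idem w ⟩
    root f w            ≡⟨ attach-root-kept f u v ¬p ⟨
    root f′ w           ∎
    where open ≡-Reasoning

  attach-fixed⇒fixed : ∀ {x} → root f′ x ≡ x → root f x ≡ x
  attach-fixed⇒fixed {x} fixed with toSum (root f x ≟ root f v)
  ... | inj₁ p  = trans (cong (root f) x≡ru) (trans (root-idem u) (sym x≡ru))
    where
    x≡ru : x ≡ root f u
    x≡ru = trans (sym fixed) (attach-root-moved f u v p)
  ... | inj₂ ¬p = trans (sym (attach-root-kept f u v ¬p)) fixed

  attach-root-unlinked : ∀ x → root f′ x ≡ x → link f′ x ≡ nothing
  attach-root-unlinked x fixed with toSum (x ≟ root f v)
  ... | inj₁ x≡rv = contradiction (begin
    root f u  ≡⟨ attach-root-moved f u v (trans (cong (root f) x≡rv) (root-idem v)) ⟨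
    root f′ x ≡⟨ fixed ⟩
    x         ≡⟨ x≡rv ⟩
    root f v  ∎) apart
    where open ≡-Reasoning
  ... | inj₂ x≢rv = trans (attach-link-kept f u v x≢rv) (root-unlinked x (attach-fixed⇒fixed fixed))

  attach-link-edge : ∀ x {u′ v′} → link f′ x ≡ just (u′ , v′) → H u′ v′
  attach-link-edge x linked with toSum (x ≟ root f v)
  ... | inj₁ x≡rv = subst (uncurry H) (just-injective (trans (sym (attach-link-new f u v x≡rv)) linked)) edge
  ... | inj₂ x≢rv = link-edge x (trans (sym (attach-link-kept f u v x≢rv)) linked)

  linked⇒≢root : ∀ {x e} → link f x ≡ just e → x ≢ root f v
  linked⇒≢root linked refl with () ← trans (sym (root-unlinked _ (root-idem v))) linked

  attach-linkConstant : {g : Fin N → A} → LinkConstant f′ g → LinkConstant f g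
  attach-linkConstant const x linked = const x (trans (attach-link-kept f u v (linked⇒≢root linked)) linked)

  attach-linkConstant⇒rootConstant : (g : Fin N → A) → LinkConstant f′ g → ∀ w → g w ≡ g (root f′ w)
  attach-linkConstant⇒rootConstant g const w with toSum (root f w ≟ root f v)
  ... | inj₁ p = begin
    g w           ≡⟨ toRoot w ⟩
    g (root f w)  ≡⟨ cong g p ⟩
    g (root f v)  ≡⟨ toRoot v ⟨
    g v           ≡⟨ const (root f v) (attach-link-new f u v refl) ⟨
    g u           ≡⟨ toRoot u ⟩
    g (root f u)  ≡⟨ cong g (attach-root-moved f u v p) ⟨
    g (root f′ w) ∎
    where
    open ≡-Reasoning
    toRoot : ∀ x → g x ≡ g (root f x)
    toRoot = linkConstant⇒rootConstant g (attach-linkConstant const)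
  ... | inj₂ ¬p = trans (linkConstant⇒rootConstant g (attach-linkConstant const) w)
                        (cong g (sym (attach-root-kept f u v ¬p)))

  attach-isForest : IsForest H f′
  attach-isForest = record
    { root-idem                 = attach-root-idem
    ; root-unlinked             = attach-root-unlinked
    ; link-edge                 = attach-link-edge
    ; linkConstant⇒rootConstant = attach-linkConstant⇒rootConstant
    }

module _ {H : Fin N → Fin N → Set} (H? : Decidable H) where

  grow : Fin N × Fin N → Forest N → Forest N
  grow (u , v) f with H? u v | root f u ≟ root f v
  ... | yes _ | no _  = attach f u v
  ... | yes _ | yes _ = f
  ... | no _  | _     = f

  grow-isForest : ∀ e {f} → IsForest H f → IsForest H (grow e f)
  grow-isForest (u , v) {f} isForest with H? u v | root f u ≟ root f v
  ... | yes edge | no apart = attach-isForest isForest edge apart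
  ... | yes _    | yes _    = isForest
  ... | no _     | _        = isForest

  grow-joins : ∀ {u v} f → H u v → root (grow (u , v) f) u ≡ root (grow (u , v) f) v
  grow-joins {u} {v} f edge with H? u v | root f u ≟ root f v
  ... | yes _ | no apart = trans (attach-root-kept f u v apart) (sym (attach-root-moved f u v refl))
  ... | yes _ | yes same = same
  ... | no ¬edge | _     = contradiction edge ¬edge

  grow-keeps-joined : ∀ e f {i j} → root f i ≡ root f j → root (grow e f) i ≡ root (grow e f) j
  grow-keeps-joined (u , v) f same with H? u v | root f u ≟ root f v
  ... | yes _ | no _  = cong (λ r → if does (r ≟ root f v) then root f u else r) same
  ... | yes _ | yes _ = same
  ... | no _  | _     = same

  foldr-grow-isForest : ∀ es → IsForest H (foldr grow discrete es)
  foldr-grow-isForest []       = discrete-isForest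
  foldr-grow-isForest (e ∷ es) = grow-isForest e (foldr-grow-isForest es)

  foldr-grow-joins : ∀ es {i j} → (i , j) ∈ es → H i j →
                     root (foldr grow discrete es) i ≡ root (foldr grow discrete es) j
  foldr-grow-joins (_ ∷ es) (here refl) edge = grow-joins (foldr grow discrete es) edge
  foldr-grow-joins (e ∷ es) (there i,j∈es) edge = grow-keeps-joined e _ (foldr-grow-joins es i,j∈es edge)

record SpanningForest {N} (H : Fin N → Fin N → Set) : Set₁ where
  field
    forest   : Forest N
    isForest : IsForest H forest
    spans    : ∀ {i j} → H i j → root forest i ≡ root forest j

spanningForest : {H : Fin N → Fin N → Set} → Decidable H → SpanningForest H
spanningForest {N} H? = record
  { forest   = foldr (grow H?) discrete edges
  ; isForest = foldr-grow-isForest H? edges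
  ; spans    = λ {i} {j} → foldr-grow-joins H? edges (∈-cartesianProduct⁺ (∈-allFin i) (∈-allFin j))
  }
  where
  edges : List (Fin N × Fin N)
  edges = cartesianProduct (allFin N) (allFin N)

bit : Forest N → Sub N → Fin N → Bool
bit f O x = maybe′ (uncurry O) false (link f x)

SameBits : Forest N → Sub N → Sub N → Set
SameBits f O₁ O₂ = ∀ x → bit f O₁ x ≡ bit f O₂ x

sameBits-link : {f : Forest N} {O₁ O₂ : Sub N} → SameBits f O₁ O₂ →
                ∀ {x u v} → link f x ≡ just (u , v) → O₁ u v ≡ O₂ u v
sameBits-link {f = f} {O₁} {O₂} same {x} {u} {v} linked = begin
  O₁ u v     ≡⟨ cong (maybe′ (uncurry O₁) false) linked ⟨
  bit f O₁ x ≡⟨ same x ⟩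
  bit f O₂ x ≡⟨ cong (maybe′ (uncurry O₂) false) linked ⟩
  O₂ u v     ∎
  where open ≡-Reasoning

-- The root of vertex 0 carries no link, so the bits at the other n vertices suffice.
forestCode : Forest (suc n) → Sub (suc n) → Fin (2 ^ n)
forestCode f O = boolsToFin (λ k → bit f O (punchIn (root f zero) k))

forestCode-injective : {H : Fin (suc n) → Fin (suc n) → Set} {f : Forest (suc n)} → IsForest H f →
                       {O₁ O₂ : Sub (suc n)} → forestCode f O₁ ≡ forestCode f O₂ → SameBits f O₁ O₂
forestCode-injective {f = f} isForest {O₁} {O₂} eq x with root f zero ≟ x
... | yes refl = begin
  bit f O₁ (root f zero) ≡⟨ cong (maybe′ (uncurry O₁) false) unlinked ⟩
  false                  ≡⟨ cong (maybe′ (uncurry O₂) false) unlinked ⟨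
  bit f O₂ (root f zero) ∎
  where
  open ≡-Reasoning
  unlinked : link f (root f zero) ≡ nothing
  unlinked = IsForest.root-unlinked isForest _ (IsForest.root-idem isForest zero)
... | no root≢x = subst (λ y → bit f O₁ y ≡ bit f O₂ y) (punchIn-punchOut root≢x)
                     (boolsToFin-injective eq (punchOut root≢x))

sub-swap : ∀ a b c d → a - b ≡ c - d → a - c ≡ b - d
sub-swap a b c d eq = begin
  a - c
    ≡⟨ solve 4 (λ a b c d → a :- c := (a :- b) :- (c :- d) :+ (b :- d)) refl a b c d ⟩
  (a - b) - (c - d) + (b - d) ≡⟨ cong (λ t → t - (c - d) + (b - d)) eq ⟩
  (c - d) - (c - d) + (b - d) ≡⟨ solve 3 (λ x y z → x :- y :- (x :- y) :+ z := z) refl c d (b - d) ⟩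
  b - d                       ∎
  where open ≡-Reasoning

neg-sub : ∀ x y → - (x - y) ≡ y - x
neg-sub = solve 2 (λ x y → :- (x :- y) := y :- x) refl

sub-÷ : ∀ x y b .{{_ : NonZero b}} → x ÷ b - y ÷ b ≡ (x - y) ÷ b
sub-÷ x y b = solve 3 (λ x y z → x :* z :- y :* z := (x :- y) :* z) refl x y (1/ b)

record IsUnitPotential {N} (G : SimpleGraph N) (O : Sub N) (c : Fin N → ℚ) : Set where
  field
    ⊆∇        : O ⊆∇ G
    unit-drop : ∀ i j → adj G i j ≡ true → (O i j ≡ true ⇔ c i - c j ≡ 1ℚ)

bounded-by-0⇒≡0 : (G : SimpleGraph N) (a : Fin N → ℚ) →
                  (∀ i j → adj G i j ≡ true → a i - a j ≤ℚ 0ℚ) →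
                  ∀ i j → adj G i j ≡ true → a i - a j ≡ 0ℚ
bounded-by-0⇒≡0 G a bound i j edge =
  ≤-antisym (bound i j edge)
            (subst (0ℚ ≤ℚ_) (neg-sub (a j) (a i))
                   (neg-antimono-≤ (bound j i (trans (SimpleGraph.sym G j i) edge))))

≡⇔÷≡1 : ∀ x b .{{_ : NonZero b}} → x ≡ b ⇔ x ÷ b ≡ 1ℚ
≡⇔÷≡1 x b = mk⇔ (λ x≡b → trans (cong (_÷ b) x≡b) (*-inverseʳ b)) λ x÷b≡1 → begin
  x              ≡⟨ *-identityʳ x ⟨
  x * 1ℚ         ≡⟨ cong (x *_) (*-inverseˡ b) ⟨
  x * (1/ b * b) ≡⟨ *-assoc x (1/ b) b ⟨
  x ÷ b * b      ≡⟨ cong (_* b) x÷b≡1 ⟩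
  1ℚ * b         ≡⟨ *-identityˡ b ⟩
  b              ∎
  where open ≡-Reasoning

properFace⇒unitPotential : {G : SimpleGraph N} {X : Sub N} → IsProperFace G X →
                           Σ (Fin N → ℚ) (IsUnitPotential G X)
properFace⇒unitPotential {G = G} {X} ((X⊆∇ , a , b , bound , X⇔) , proper) =
  (λ i → a i ÷ b) , record { ⊆∇ = X⊆∇ ; unit-drop = unit-drop }
  where
  b≢0 : ¬ b ≡ 0ℚ
  b≢0 refl = proper λ i j edge → from (X⇔ i j edge) (bounded-by-0⇒≡0 G a bound i j edge)
  instance
    b-nonZero : NonZero b
    b-nonZero = ≢-nonZero b≢0
  unit-drop : ∀ i j → adj G i j ≡ true → (X i j ≡ true ⇔ a i ÷ b - a j ÷ b ≡ 1ℚ)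
  unit-drop i j edge = mk⇔
    (λ i,j∈X → trans (sub-÷ (a i) (a j) b) (to (≡⇔÷≡1 _ b) (to (X⇔ i j edge) i,j∈X)))
    (λ drop → from (X⇔ i j edge) (from (≡⇔÷≡1 _ b) (trans (sym (sub-÷ (a i) (a j) b)) drop)))

module _ {G : SimpleGraph N} {O : Sub N} {c : Fin N → ℚ} (P : IsUnitPotential G O c) where
  open IsUnitPotential P

  ∈⇒drop : ∀ {i j} → O i j ≡ true → c i - c j ≡ 1ℚ
  ∈⇒drop {i} {j} i,j∈O = to (unit-drop i j (⊆∇ i j i,j∈O)) i,j∈O

  drop⇒∈ : ∀ {i j} → adj G i j ≡ true → c i - c j ≡ 1ℚ → O i j ≡ true
  drop⇒∈ {i} {j} edge = from (unit-drop i j edge)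

module _ {G : SimpleGraph N} {O₁ O₂ : Sub N} {c₁ c₂ : Fin N → ℚ}
         (P₁ : IsUnitPotential G O₁ c₁) (P₂ : IsUnitPotential G O₂ c₂) where

  gap : Fin N → ℚ
  gap k = c₁ k - c₂ k

  bothIn⇒gap≡ : ∀ {i j} → O₁ i j ≡ true → O₂ i j ≡ true → gap i ≡ gap j
  bothIn⇒gap≡ {i} {j} i,j∈O₁ i,j∈O₂ =
    sub-swap (c₁ i) (c₁ j) (c₂ i) (c₂ j) (trans (∈⇒drop P₁ i,j∈O₁) (sym (∈⇒drop P₂ i,j∈O₂)))

  sameOrientation⇒gap≡ : ∀ {u v} → GEdge O₁ u v → GEdge O₂ u v → O₁ u v ≡ O₂ u v → gap u ≡ gap v
  sameOrientation⇒gap≡ (inj₁ u,v∈O₁) _              same = bothIn⇒gap≡ u,v∈O₁ (trans (sym same) u,v∈O₁)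
  sameOrientation⇒gap≡ (inj₂ _)      (inj₁ u,v∈O₂) same = bothIn⇒gap≡ (trans same u,v∈O₂) u,v∈O₂
  sameOrientation⇒gap≡ (inj₂ v,u∈O₁) (inj₂ v,u∈O₂) _    = sym (bothIn⇒gap≡ v,u∈O₁ v,u∈O₂)

  gap≡⇒⊆ : ∀ {i j} → gap i ≡ gap j → O₁ i j ≡ true → O₂ i j ≡ true
  gap≡⇒⊆ {i} {j} gap≡ i,j∈O₁ = drop⇒∈ P₂ (IsUnitPotential.⊆∇ P₁ i j i,j∈O₁)
    (trans (sym (sub-swap (c₁ i) (c₂ i) (c₁ j) (c₂ j) gap≡)) (∈⇒drop P₁ i,j∈O₁))

SameEdges : Sub N → Sub N → Set
SameEdges X Y = ∀ i j → GEdge X i j ⇔ GEdge Y i j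

module _ {G : SimpleGraph N} {F : Sub N} (S : SpanningForest (GEdge F)) where
  open SpanningForest S
  open IsForest isForest

  sameBits⇒⊆ : ∀ {O₁ O₂ c₁ c₂} → IsUnitPotential G O₁ c₁ → IsUnitPotential G O₂ c₂ →
               SameEdges O₁ F → SameEdges O₂ F → SameBits forest O₁ O₂ → O₁ ⊆ˢ O₂
  sameBits⇒⊆ P₁ P₂ edges₁ edges₂ same i j i,j∈O₁ = gap≡⇒⊆ P₁ P₂ (begin
    gap P₁ P₂ i               ≡⟨ toRoot i ⟩
    gap P₁ P₂ (root forest i) ≡⟨ cong (gap P₁ P₂) (spans (to (edges₁ i j) (inj₁ i,j∈O₁))) ⟩
    gap P₁ P₂ (root forest j) ≡⟨ toRoot j ⟨
    gap P₁ P₂ j               ∎) i,j∈O₁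
    where
    open ≡-Reasoning
    gap-linkConstant : LinkConstant forest (gap P₁ P₂)
    gap-linkConstant x {u} {v} linked =
      sameOrientation⇒gap≡ P₁ P₂ (from (edges₁ u v) edge) (from (edges₂ u v) edge)
                           (sameBits-link {f = forest} same linked)
      where
      edge : GEdge F u v
      edge = link-edge x linked
    toRoot : ∀ x → gap P₁ P₂ x ≡ gap P₁ P₂ (root forest x)
    toRoot = linkConstant⇒rootConstant (gap P₁ P₂) gap-linkConstant

  sameBits⇒sameSub : ∀ {O₁ O₂ c₁ c₂} → IsUnitPotential G O₁ c₁ → SameEdges O₁ F →
                     IsUnitPotential G O₂ c₂ → SameEdges O₂ F → SameBits forest O₁ O₂ → SameSub O₁ O₂
  sameBits⇒sameSub P₁ edges₁ P₂ edges₂ same i j = ⇔→≡ (mk⇔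
    (sameBits⇒⊆ P₁ P₂ edges₁ edges₂ same i j)
    (sameBits⇒⊆ P₂ P₁ edges₂ edges₁ (sym ∘ same) i j))

GEdge? : (X : Sub N) → Decidable (GEdge X)
GEdge? X i j = (X i j ≟ᴮ true) ⊎-dec (X j i ≟ᴮ true)

mainTheorem7 : (N : ℕ) (G : SimpleGraph N) → Connected G → HasEdge G →
               (F : Sub N) → IsFacet G F →
               (L : List (Sub N)) →
               All (λ F′ → IsFacet G F′ × SameGraph F′ F) L →
               AllPairs (λ X Y → ¬ SameSub X Y) L →
               length L ≤ 2 ^ (N ∸ 1)
mainTheorem7 zero    _ _ (() , _) _ _ _ _ _
mainTheorem7 (suc n) G _ _ F _ L facets distinct = begin
  length L            ≡⟨ length-map code L ⟨
  length (map code L) ≤⟨ Unique⇒length≤ (allPairs-map code-separates facets distinct) ⟩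
  2 ^ n               ∎
  where
  open ≤-Reasoning
  S : SpanningForest (GEdge F)
  S = spanningForest (GEdge? F)
  open SpanningForest S using (forest; isForest)
  code : Sub (suc n) → Fin (2 ^ n)
  code = forestCode forest
  code-separates : ∀ {X Y} → IsFacet G X × SameGraph X F → IsFacet G Y × SameGraph Y F →
                   ¬ SameSub X Y → code X ≢ code Y
  code-separates ((X-face , _) , (X-edges , _)) ((Y-face , _) , (Y-edges , _)) X≢Y codes≡ =
    X≢Y (sameBits⇒sameSub S
           (proj₂ (properFace⇒unitPotential {G = G} X-face)) X-edges
           (proj₂ (properFace⇒unitPotential {G = G} Y-face)) Y-edges
           (forestCode-injective isForest codes≡))
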